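{- Let $n$ be a positive integer and let $\mathcal{B}$ be a balanced bipartite graph on $2n$ vertices with parts $V_1$ and $V_2$ (each of size $n$), and suppose $\delta(\mathcal{B})\geq \frac{n}{2}+1$. If $S\subseteq V(\mathcal{B})$ has $|S|=n+1$ and the induced subgraph $\mathcal{B}[S]$ is a forest, then $|S\cap V_1|\in\{1,2,\frac{n}{2}\}$ or $|S\cap V_2|\in\{1,2,\frac{n}{2}\}$.
   Context: All graphs are finite and simple. A balanced bipartite graph on $2n$ vertices is a bipartite graph with bipartition $V_1,V_2$, $|V_1|=|V_2|=n$. $\delta(G)$ is the minimum degree and $G[S]$ is the subgraph induced by $S$. -}

module Defs where

open import Data.Nat using (ℕ; _+_; _*_; _≤_)
open import Data.Bool using (Bool; true; false; T)
open import Data.Fin using (Fin)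
open import Data.Fin.Subset using (Subset; _∈_; ∣_∣)
open import Data.Vec using (tabulate)
open import Data.Sum using (_⊎_; inj₁; inj₂)
open import Data.List using (List; []; _∷_; length)
open import Data.List.Relation.Unary.All using (All)
open import Data.List.Relation.Unary.Unique.Propositional using (Unique)
open import Data.Product using (_×_; Σ)
open import Data.Empty using (⊥)
open import Relation.Nullary using (¬_)

-- A balanced bipartite graph on 2n vertices with parts V₁ = V₂ = Fin n,
-- given by its biadjacency relation: E i j = true iff i ∈ V₁ is adjacent to j ∈ V₂.
-- (Bipartite graphs have no edges inside a part; simplicity is automatic.)
BipGraph : ℕ → Set
BipGraph n = Fin n → Fin n → Bool

Vertex : ℕ → Set
Vertex n = Fin n ⊎ Fin n

Adj : ∀ {n} → BipGraph n → Vertex n → Vertex n → Set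
Adj E (inj₁ i) (inj₂ j) = T (E i j)
Adj E (inj₂ j) (inj₁ i) = T (E i j)
Adj E (inj₁ _) (inj₁ _) = ⊥
Adj E (inj₂ _) (inj₂ _) = ⊥

degree : ∀ {n} → BipGraph n → Vertex n → ℕ
degree E (inj₁ i) = ∣ tabulate (λ j → E i j) ∣
degree E (inj₂ j) = ∣ tabulate (λ i → E i j) ∣

-- δ(B) ≥ n/2 + 1, written without division as 2·deg(v) ≥ n + 2 for every v.
MinDegreeAtLeastHalfPlusOne : ∀ {n} → BipGraph n → Set
MinDegreeAtLeastHalfPlusOne {n} E = ∀ v → n + 2 ≤ 2 * degree E v

InS : ∀ {n} → Subset n → Subset n → Vertex n → Set
InS S₁ S₂ (inj₁ i) = i ∈ S₁
InS S₁ S₂ (inj₂ j) = j ∈ S₂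

ClosedWalkFrom : ∀ {n} → BipGraph n → Vertex n → List (Vertex n) → Set
ClosedWalkFrom E x₀ [] = ⊥
ClosedWalkFrom E x₀ (x ∷ []) = Adj E x x₀
ClosedWalkFrom E x₀ (x ∷ y ∷ xs) = Adj E x y × ClosedWalkFrom E x₀ (y ∷ xs)

IsCycle : ∀ {n} → BipGraph n → List (Vertex n) → Set
IsCycle E [] = ⊥
IsCycle E (x ∷ xs) = 3 ≤ length (x ∷ xs) × Unique (x ∷ xs) × ClosedWalkFrom E x (x ∷ xs)

InducedForest : ∀ {n} → BipGraph n → Subset n → Subset n → Set
InducedForest E S₁ S₂ = ¬ Σ (List (Vertex _)) (λ c → All (InS S₁ S₂) c × IsCycle E c)

-- Let a = |S ∩ V₁| ≤ b = |S ∩ V₂| (the other case is symmetric) and c = b − a, so 2a + c = n + 1.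
-- A vertex of S ∩ V₁ misses at most n − (n/2 + 1) vertices of V₂, so it has at least
-- b − n/2 + 1 = (c + 3)/2, hence at least 2 + ⌊c/2⌋, neighbours in S ∩ V₂.  When a ≥ 3 and c ≠ 1
-- (that is, a ∉ {1, 2} and 2a ≠ n) this gives a(2 + ⌊c/2⌋) ≥ 2a + c = n + 1 edges in B[S], but a
-- graph on n + 1 vertices with at least n + 1 edges contains a cycle.

module Submission where

open import Defs
open import Data.Nat using (ℕ; _+_; _*_; _≤_)
open import Data.Fin.Subset using (Subset; ∣_∣)
open import Data.Sum using (_⊎_)
open import Relation.Binary.PropositionalEquality using (_≡_)

open import Data.Bool using (Bool; true; false; T)
open import Data.Empty using (⊥; ⊥-elim)
open import Data.Fin using (Fin)
import Data.Fin as Fin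
import Data.Fin.Properties as Fin
open import Data.Fin.Subset using () renaming (_∈_ to _∈ₛ_)
open import Data.Fin.Subset.Properties using (∣p∣≤n)
open import Data.List using (List; []; _∷_; _++_; [_]; map; length)
open import Data.List.Properties using (length-++; length-map; ++-assoc)
open import Data.List.Membership.Propositional using (_∈_; find)
open import Data.List.Membership.Propositional.Properties using (∈-∃++; ∈-map⁻; ∈-++⁻)
open import Data.List.Relation.Unary.All as All using (All; []; _∷_; all?)
open import Data.List.Relation.Unary.All.Properties
  using (¬All⇒Any¬; ¬Any⇒All¬; ++⁻ˡ) renaming (map⁺ to All-map⁺)
open import Data.List.Relation.Unary.AllPairs using ([]; _∷_)
open import Data.List.Relation.Unary.Any using (here; there)
open import Data.List.Relation.Unary.Unique.Propositional using (Unique)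
open import Data.List.Relation.Unary.Unique.Propositional.Properties
  using () renaming (map⁺ to Unique-map⁺; ++⁺ to Unique-++⁺)
open import Data.Nat using (zero; suc; _<_; z≤n; s≤s; _≟_; _≤?_; _∸_; ⌊_/2⌋; ⌈_/2⌉)
open import Data.Nat.Properties
open import Data.Nat.Tactic.RingSolver using (solve-∀)
open import Algebra.Properties.CommutativeSemigroup +-commutativeSemigroup
  using (interchange; x∙yz≈y∙xz)
open import Data.Product using (Σ; _×_; _,_)
open import Data.Sum using (inj₁; inj₂)
open import Data.Sum.Properties using (≡-dec; inj₁-injective; inj₂-injective)
open import Data.Unit using (⊤; tt)
open import Data.Vec using ([]; _∷_; tabulate; here; there)
open import Function using (_∘_)
open import Relation.Binary.Definitions using (DecidableEquality)
open import Relation.Binary.PropositionalEquality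
  using (refl; sym; trans; cong; cong₂; subst; subst₂; _≢_; module ≡-Reasoning)
open import Relation.Nullary using (¬_; Dec; yes; no; contradiction)
open import Relation.Nullary.Decidable using (_⊎-dec_)

∑ : {A : Set} → (A → ℕ) → List A → ℕ
∑ f []       = 0
∑ f (x ∷ xs) = f x + ∑ f xs

module _ {A : Set} where

  ∑-++ : ∀ (f : A → ℕ) xs ys → ∑ f (xs ++ ys) ≡ ∑ f xs + ∑ f ys
  ∑-++ f []       ys = refl
  ∑-++ f (x ∷ xs) ys = trans (cong (f x +_) (∑-++ f xs ys)) (sym (+-assoc (f x) _ _))

  ∑-insert : ∀ (f : A → ℕ) xs v ys → ∑ f (xs ++ v ∷ ys) ≡ f v + ∑ f (xs ++ ys)
  ∑-insert f []       v ys = refl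
  ∑-insert f (x ∷ xs) v ys = trans (cong (f x +_) (∑-insert f xs v ys)) (x∙yz≈y∙xz (f x) (f v) _)

  ∑-cong : ∀ {f g : A → ℕ} xs → (∀ x → f x ≡ g x) → ∑ f xs ≡ ∑ g xs
  ∑-cong []       f≗g = refl
  ∑-cong (x ∷ xs) f≗g = cong₂ _+_ (f≗g x) (∑-cong xs f≗g)

  ∑-mono-≤ : ∀ {f g : A → ℕ} xs → (∀ x → f x ≤ g x) → ∑ f xs ≤ ∑ g xs
  ∑-mono-≤ []       f≤g = z≤n
  ∑-mono-≤ (x ∷ xs) f≤g = +-mono-≤ (f≤g x) (∑-mono-≤ xs f≤g)

  ∑-zero : ∀ (xs : List A) → ∑ (λ _ → 0) xs ≡ 0
  ∑-zero []       = refl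
  ∑-zero (x ∷ xs) = ∑-zero xs

  ∑-distrib-+ : ∀ (f g : A → ℕ) xs → ∑ (λ x → f x + g x) xs ≡ ∑ f xs + ∑ g xs
  ∑-distrib-+ f g []       = refl
  ∑-distrib-+ f g (x ∷ xs) =
    trans (cong (f x + g x +_) (∑-distrib-+ f g xs)) (interchange (f x) (g x) _ _)

  length*≤∑ : ∀ (f : A → ℕ) k xs → All (λ x → k ≤ f x) xs → length xs * k ≤ ∑ f xs
  length*≤∑ f k []       []         = z≤n
  length*≤∑ f k (x ∷ xs) (k≤fx ∷ ks) = +-mono-≤ k≤fx (length*≤∑ f k xs ks)

  ∑-map : ∀ {B : Set} (f : B → ℕ) (g : A → B) xs → ∑ f (map g xs) ≡ ∑ (f ∘ g) xs
  ∑-map f g []       = refl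
  ∑-map f g (x ∷ xs) = cong (f (g x) +_) (∑-map f g xs)

∑-comm : ∀ {A B : Set} (g : A → B → ℕ) xs ys →
         ∑ (λ x → ∑ (g x) ys) xs ≡ ∑ (λ y → ∑ (λ x → g x y) xs) ys
∑-comm g []       ys = sym (∑-zero ys)
∑-comm g (x ∷ xs) ys = trans (cong (∑ (g x) ys +_) (∑-comm g xs ys))
                             (sym (∑-distrib-+ (g x) (λ y → ∑ (λ x → g x y) xs) ys))

module _ {A : Set} where

  Unique-++⁻ˡ : ∀ (xs ys : List A) → Unique (xs ++ ys) → Unique xs
  Unique-++⁻ˡ []       ys _            = []
  Unique-++⁻ˡ (x ∷ xs) ys (x∉ ∷ uniq) = ++⁻ˡ xs x∉ ∷ Unique-++⁻ˡ xs ys uniq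

  All-remove : ∀ {P : A → Set} (xs : List A) {v ys} → All P (xs ++ v ∷ ys) → All P (xs ++ ys)
  All-remove []       (_ ∷ ps)  = ps
  All-remove (x ∷ xs) (px ∷ ps) = px ∷ All-remove xs ps

  length-insert : ∀ (xs : List A) {v ys} → length (xs ++ v ∷ ys) ≡ suc (length (xs ++ ys))
  length-insert []       = refl
  length-insert (x ∷ xs) = cong suc (length-insert xs)

  Unique-remove : ∀ (xs : List A) {v ys} → Unique (xs ++ v ∷ ys) → Unique (xs ++ ys)
  Unique-remove []       (_ ∷ uniq)   = uniq
  Unique-remove (x ∷ xs) (x∉ ∷ uniq) = All-remove xs x∉ ∷ Unique-remove xs uniq

  ∈-remove : ∀ (xs : List A) {v w ys} → w ∈ xs ++ v ∷ ys → v ≢ w → w ∈ xs ++ ys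
  ∈-remove []       (here refl) v≢w = ⊥-elim (v≢w refl)
  ∈-remove []       (there w∈)  v≢w = w∈
  ∈-remove (x ∷ xs) (here refl) v≢w = here refl
  ∈-remove (x ∷ xs) (there w∈)  v≢w = there (∈-remove xs w∈ v≢w)

  ∈-insert : ∀ (xs : List A) {v w ys} → w ∈ xs ++ ys → w ∈ xs ++ v ∷ ys
  ∈-insert []       w∈          = there w∈
  ∈-insert (x ∷ xs) (here refl) = here refl
  ∈-insert (x ∷ xs) (there w∈)  = there (∈-insert xs w∈)

  Unique⇒length≤ : ∀ (ps xs : List A) → Unique ps → All (_∈ xs) ps → length ps ≤ length xs
  Unique⇒length≤ []       xs _            _           = z≤n
  Unique⇒length≤ (p ∷ ps) xs (p∉ ∷ uniq) (p∈ ∷ ps⊆) with ∈-∃++ p∈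
  ... | ys , zs , refl = subst (suc (length ps) ≤_) (sym (length-insert ys))
                           (s≤s (Unique⇒length≤ ps (ys ++ zs) uniq (remove-p p∉ ps⊆)))
    where
    remove-p : ∀ {qs} → All (p ≢_) qs → All (_∈ ys ++ p ∷ zs) qs → All (_∈ ys ++ zs) qs
    remove-p []          []          = []
    remove-p (p≢q ∷ p≢s) (q∈ ∷ qs⊆) = ∈-remove ys q∈ p≢q ∷ remove-p p≢s qs⊆

3+c≤2*d⇒2+⌊c/2⌋≤d : ∀ c d → 3 + c ≤ 2 * d → 2 + ⌊ c /2⌋ ≤ d
3+c≤2*d⇒2+⌊c/2⌋≤d c d 3+c≤2d = begin
  2 + ⌊ c /2⌋  ≡⟨⟩
  ⌈ 3 + c /2⌉  ≤⟨ ⌈n/2⌉-mono 3+c≤2d ⟩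
  ⌈ 2 * d /2⌉  ≡⟨ cong ⌈_/2⌉ (cong (d +_) (+-identityʳ d)) ⟩
  ⌈ d + d /2⌉  ≡⟨ sym (n≡⌈n+n/2⌉ d) ⟩
  d            ∎
  where open ≤-Reasoning

a+[a+c]≤a*[2+⌊c/2⌋] : ∀ {a} c → 3 ≤ a → c ≢ 1 → a + (a + c) ≤ a * (2 + ⌊ c /2⌋)
a+[a+c]≤a*[2+⌊c/2⌋] {a} 0 _ _ = ≤-reflexive (*-comm 2 a)
a+[a+c]≤a*[2+⌊c/2⌋] 1 _ c≢1 = contradiction refl c≢1
a+[a+c]≤a*[2+⌊c/2⌋] {a} 2 3≤a _ =
  ≤-trans (+-monoʳ-≤ a (+-monoʳ-≤ a (n≤1+n 2))) (a+[a+c]≤a*[2+⌊c/2⌋] 3 3≤a λ ())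
a+[a+c]≤a*[2+⌊c/2⌋] {a} 3 3≤a _ = begin
  a + (a + 3)  ≤⟨ +-monoʳ-≤ a (+-monoʳ-≤ a (≤-trans 3≤a (≤-reflexive (sym (+-identityʳ a))))) ⟩
  3 * a        ≡⟨ *-comm 3 a ⟩
  a * 3        ∎
  where open ≤-Reasoning
a+[a+c]≤a*[2+⌊c/2⌋] {a} (suc (suc c@(suc (suc _)))) 3≤a _ = begin
  a + (a + (2 + c))      ≡⟨ shift-2 a c ⟩
  2 + (a + (a + c))      ≤⟨ +-mono-≤ (≤-trans (n≤1+n 2) 3≤a) (a+[a+c]≤a*[2+⌊c/2⌋] c 3≤a λ ()) ⟩
  a + a * (2 + ⌊ c /2⌋)  ≡⟨ sym (*-suc a _) ⟩
  a * (3 + ⌊ c /2⌋)      ∎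
  where
  open ≤-Reasoning
  shift-2 : ∀ a c → a + (a + (2 + c)) ≡ 2 + (a + (a + c))
  shift-2 = solve-∀

-- D is the degree of a vertex and d its number of neighbours among the a + c vertices of S on the other side.
3+c≤2*d : ∀ {n a c D d} → a + (a + c) ≡ n + 1 → n + 2 ≤ 2 * D → D + (a + c) ≤ n + d → 3 + c ≤ 2 * d
3+c≤2*d {n} {a} {c} {D} {d} size n+2≤2D D+[a+c]≤n+d = +-cancelˡ-≤ (2 * n) _ _ (begin
  2 * n + (3 + c)              ≡⟨ regroup₁ n c ⟩
  n + 2 + c + (n + 1)          ≡⟨ cong (n + 2 + c +_) (sym size) ⟩
  n + 2 + c + (a + (a + c))    ≡⟨ regroup₂ n a c ⟩
  n + 2 + 2 * (a + c)          ≤⟨ +-monoˡ-≤ (2 * (a + c)) n+2≤2D ⟩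
  2 * D + 2 * (a + c)          ≡⟨ sym (*-distribˡ-+ 2 D (a + c)) ⟩
  2 * (D + (a + c))            ≤⟨ *-monoʳ-≤ 2 D+[a+c]≤n+d ⟩
  2 * (n + d)                  ≡⟨ *-distribˡ-+ 2 n d ⟩
  2 * n + 2 * d                ∎)
  where
  open ≤-Reasoning
  regroup₁ : ∀ n c → 2 * n + (3 + c) ≡ n + 2 + c + (n + 1)
  regroup₁ = solve-∀
  regroup₂ : ∀ n a c → n + 2 + c + (a + (a + c)) ≡ n + 2 + 2 * (a + c)
  regroup₂ = solve-∀

a+[a+1]≢n+1 : ∀ {n a} → 2 * a ≢ n → a + (a + 1) ≢ n + 1
a+[a+1]≢n+1 {n} {a} 2a≢n eq = 2a≢n (+-cancelʳ-≡ 1 (2 * a) n (trans (double+1 a) eq))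
  where
  double+1 : ∀ a → 2 * a + 1 ≡ a + (a + 1)
  double+1 = solve-∀

boolToℕ : Bool → ℕ
boolToℕ false = 0
boolToℕ true  = 1

module SimpleGraph {V : Set} (_≟_ : DecidableEquality V) (adj : V → V → Bool)
                   (adj-sym : ∀ x y → adj x y ≡ adj y x) (adj-irrefl : ∀ x → adj x x ≡ false) where

  open import Data.List.Membership.DecPropositional _≟_ using (_∈?_)

  _~_ : V → V → Set
  x ~ y = T (adj x y)

  ~-sym : ∀ {x y} → x ~ y → y ~ x
  ~-sym {x} {y} = subst T (adj-sym x y)

  ~-irrefl : ∀ {x} → ¬ x ~ x
  ~-irrefl {x} = subst T (adj-irrefl x)

  degreeIn : List V → V → ℕ
  degreeIn xs u = ∑ (boolToℕ ∘ adj u) xs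

  degreeSum : List V → ℕ
  degreeSum xs = ∑ (degreeIn xs) xs

  Path : List V → Set
  Path []           = ⊤
  Path (x ∷ [])     = ⊤
  Path (x ∷ y ∷ xs) = x ~ y × Path (y ∷ xs)

  ClosedWalk : V → List V → Set
  ClosedWalk x₀ []           = ⊥
  ClosedWalk x₀ (x ∷ [])     = x ~ x₀
  ClosedWalk x₀ (x ∷ y ∷ xs) = x ~ y × ClosedWalk x₀ (y ∷ xs)

  Cycle : List V → Set
  Cycle []       = ⊥
  Cycle (x ∷ xs) = 3 ≤ length (x ∷ xs) × Unique (x ∷ xs) × ClosedWalk x (x ∷ xs)

  CycleIn : List V → Set
  CycleIn xs = Σ (List V) λ c → All (_∈ xs) c × Cycle c

  Path-++⁻ˡ : ∀ xs ys → Path (xs ++ ys) → Path xs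
  Path-++⁻ˡ []           ys _         = tt
  Path-++⁻ˡ (x ∷ [])     ys _         = tt
  Path-++⁻ˡ (x ∷ y ∷ xs) ys (x~y , p) = x~y , Path-++⁻ˡ (y ∷ xs) ys p

  Path⇒ClosedWalk : ∀ x₀ xs z → Path (xs ++ [ z ]) → z ~ x₀ → ClosedWalk x₀ (xs ++ [ z ])
  Path⇒ClosedWalk x₀ []           z _         z~x₀ = z~x₀
  Path⇒ClosedWalk x₀ (x ∷ [])     z (x~z , _) z~x₀ = x~z , z~x₀
  Path⇒ClosedWalk x₀ (x ∷ y ∷ xs) z (x~y , p) z~x₀ = x~y , Path⇒ClosedWalk x₀ (y ∷ xs) z p z~x₀

  neighbour : ∀ {x} xs → 1 ≤ degreeIn xs x → Σ V λ z → z ∈ xs × x ~ z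
  neighbour {x} (w ∷ ws) deg≥1 with adj x w in eq
  ... | true  = w , here refl , subst T (sym eq) tt
  ... | false = let z , z∈ , x~z = neighbour ws deg≥1 in z , there z∈ , x~z

  neighbour≢ : ∀ {x} y xs → Unique xs → 2 ≤ degreeIn xs x → Σ V λ z → z ∈ xs × x ~ z × z ≢ y
  neighbour≢ {x} y (w ∷ ws) (w∉ ∷ uniq) deg≥2 with adj x w in eq
  ... | false = let z , z∈ , x~z , z≢y = neighbour≢ y ws uniq deg≥2 in z , there z∈ , x~z , z≢y
  ... | true with w ≟ y
  ...   | no w≢y   = w , here refl , subst T (sym eq) tt , w≢y
  ...   | yes refl = let z , z∈ , x~z = neighbour ws (≤-pred deg≥2)
                     in z , there z∈ , x~z , λ z≡w → All.lookup w∉ z∈ (sym z≡w)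

  module Walk {xs : List V} (xs-unique : Unique xs) (degree≥2 : All (λ u → 2 ≤ degreeIn xs u) xs) where

    previous : V → List V → V
    previous x []      = x
    previous x (y ∷ _) = y

    -- x ∷ path is a walk without repeated vertices, stored backwards from its current end x.  It is
    -- extended by a neighbour of x other than the previous vertex until that neighbour is already on
    -- it, closing a cycle; by pigeonhole this happens before the fuel runs out.
    extend : ∀ fuel x path → fuel + length (x ∷ path) ≡ suc (length xs) →
             Unique (x ∷ path) → All (_∈ xs) (x ∷ path) → Path (x ∷ path) → CycleIn xs
    extend zero x path len uniq ⊆xs _ =
      ⊥-elim (1+n≰n (subst (_≤ length xs) len (Unique⇒length≤ (x ∷ path) xs uniq ⊆xs)))
    extend (suc fuel) x path len uniq ⊆xs walk
      with neighbour≢ (previous x path) xs xs-unique (All.lookup degree≥2 (All.head ⊆xs))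
    ... | z , z∈xs , x~z , z≢previous with z ∈? (x ∷ path)
    ...   | no z∉ = extend fuel z (x ∷ path) (trans (+-suc fuel _) len)
                      (¬Any⇒All¬ (x ∷ path) z∉ ∷ uniq) (z∈xs ∷ ⊆xs) (~-sym x~z , walk)
    ...   | yes z∈ with ∈-∃++ z∈
    ...     | []         , post , refl = ⊥-elim (~-irrefl x~z)
    ...     | _ ∷ []     , post , refl = ⊥-elim (z≢previous refl)
    ...     | _ ∷ w ∷ ys , post , refl =
              c , ++⁻ˡ c (subst (All (_∈ xs)) split ⊆xs) ,
              length≥3 , Unique-++⁻ˡ c post (subst Unique split uniq) ,
              Path⇒ClosedWalk x (x ∷ w ∷ ys) z (Path-++⁻ˡ c post (subst Path split walk)) (~-sym x~z)
      where
      c : List V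
      c = x ∷ w ∷ ys ++ [ z ]
      split : x ∷ w ∷ ys ++ z ∷ post ≡ c ++ post
      split = cong (λ l → x ∷ w ∷ l) (sym (++-assoc ys [ z ] post))
      length≥3 : 3 ≤ length c
      length≥3 = s≤s (s≤s (subst (1 ≤_) (sym (length-++ ys)) (m≤n+m 1 (length ys))))

  degree≥2⇒CycleIn : ∀ xs → Unique xs → All (λ u → 2 ≤ degreeIn xs u) xs → 0 < length xs → CycleIn xs
  degree≥2⇒CycleIn xs@(x ∷ _) uniq degree≥2 _ =
    Walk.extend uniq degree≥2 (length xs) x [] (+-comm (length xs) 1) ([] ∷ []) (here refl ∷ []) tt

  degreeIn-removeSelf : ∀ ys v zs → degreeIn (ys ++ v ∷ zs) v ≡ degreeIn (ys ++ zs) v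
  degreeIn-removeSelf ys v zs =
    trans (∑-insert (boolToℕ ∘ adj v) ys v zs) (cong (λ b → boolToℕ b + degreeIn (ys ++ zs) v) (adj-irrefl v))

  degreeSum-remove : ∀ ys v zs →
    degreeSum (ys ++ v ∷ zs) ≡ degreeIn (ys ++ zs) v + (degreeIn (ys ++ zs) v + degreeSum (ys ++ zs))
  degreeSum-remove ys v zs = begin
    ∑ (degreeIn xs) (ys ++ v ∷ zs)
      ≡⟨ ∑-insert (degreeIn xs) ys v zs ⟩
    degreeIn xs v + ∑ (degreeIn xs) xs'
      ≡⟨ cong₂ _+_ (degreeIn-removeSelf ys v zs) (∑-cong xs' λ u → ∑-insert (boolToℕ ∘ adj u) ys v zs) ⟩
    degreeIn xs' v + ∑ (λ u → boolToℕ (adj u v) + degreeIn xs' u) xs'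
      ≡⟨ cong (degreeIn xs' v +_) (∑-distrib-+ (λ u → boolToℕ (adj u v)) (degreeIn xs') xs') ⟩
    degreeIn xs' v + (∑ (λ u → boolToℕ (adj u v)) xs' + degreeSum xs')
      ≡⟨ cong (λ k → degreeIn xs' v + (k + degreeSum xs')) (∑-cong xs' λ u → cong boolToℕ (adj-sym u v)) ⟩
    degreeIn xs' v + (degreeIn xs' v + degreeSum xs')  ∎
    where
    open ≡-Reasoning
    xs xs' : List V
    xs = ys ++ v ∷ zs
    xs' = ys ++ zs

  -- Deleting a vertex of degree at most 1 costs at most one edge; once none is left, walk.
  dense⇒CycleIn : ∀ m xs → length xs ≡ suc m → Unique xs → 2 * suc m ≤ degreeSum xs → CycleIn xs
  dense⇒CycleIn zero (x ∷ []) _ _ dense =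
    contradiction (subst (2 ≤_) (cong (λ b → boolToℕ b + 0 + 0) (adj-irrefl x)) dense) λ ()
  dense⇒CycleIn (suc m) xs len uniq dense with all? (λ u → 2 ≤? degreeIn xs u) xs
  ... | yes degree≥2 = degree≥2⇒CycleIn xs uniq degree≥2 (subst (0 <_) (sym len) (s≤s z≤n))
  ... | no ¬degree≥2 with find (¬All⇒Any¬ (λ u → 2 ≤? degreeIn xs u) xs ¬degree≥2)
  ...   | v , v∈ , low with ∈-∃++ v∈
  ...     | ys , zs , refl =
            let c , c⊆ , cycle = dense⇒CycleIn m (ys ++ zs) (suc-injective (trans (sym (length-insert ys)) len))
                                   (Unique-remove ys uniq) dense′
            in c , All.map (∈-insert ys) c⊆ , cycle
    where
    d : ℕ
    d = degreeIn (ys ++ zs) v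
    d≤1 : d ≤ 1
    d≤1 = subst (_≤ 1) (degreeIn-removeSelf ys v zs) (≤-pred (≰⇒> low))
    dense′ : 2 * suc m ≤ degreeSum (ys ++ zs)
    dense′ = +-cancelˡ-≤ 2 _ _ (begin
      2 + 2 * suc m                     ≡⟨ sym (*-suc 2 (suc m)) ⟩
      2 * suc (suc m)                   ≤⟨ dense ⟩
      degreeSum (ys ++ v ∷ zs)          ≡⟨ degreeSum-remove ys v zs ⟩
      d + (d + degreeSum (ys ++ zs))    ≤⟨ +-mono-≤ d≤1 (+-monoˡ-≤ _ d≤1) ⟩
      2 + degreeSum (ys ++ zs)          ∎)
      where open ≤-Reasoning

elements : ∀ {n} → Subset n → List (Fin n)
elements []          = []
elements (true ∷ p)  = Fin.zero ∷ map Fin.suc (elements p)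
elements (false ∷ p) = map Fin.suc (elements p)

length-elements : ∀ {n} (p : Subset n) → length (elements p) ≡ ∣ p ∣
length-elements []          = refl
length-elements (true ∷ p)  = cong suc (trans (length-map Fin.suc (elements p)) (length-elements p))
length-elements (false ∷ p) = trans (length-map Fin.suc (elements p)) (length-elements p)

∈-elements⁻ : ∀ {n} (p : Subset n) {i} → i ∈ elements p → i ∈ₛ p
∈-elements⁻ (true ∷ p) (here refl) = here
∈-elements⁻ (true ∷ p) (there i∈) with ∈-map⁻ Fin.suc i∈
... | j , j∈ , refl = there (∈-elements⁻ p j∈)
∈-elements⁻ (false ∷ p) i∈ with ∈-map⁻ Fin.suc i∈
... | j , j∈ , refl = there (∈-elements⁻ p j∈)

elements-unique : ∀ {n} (p : Subset n) → Unique (elements p)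
elements-unique []          = []
elements-unique (true ∷ p)  =
  All-map⁺ (All.tabulate λ _ ()) ∷ Unique-map⁺ Fin.suc-injective (elements-unique p)
elements-unique (false ∷ p) = Unique-map⁺ Fin.suc-injective (elements-unique p)

neighboursIn : ∀ {n} → (Fin n → Bool) → Subset n → ℕ
neighboursIn f q = ∑ (boolToℕ ∘ f) (elements q)

∣f∣+∣q∣≤n+neighboursIn : ∀ {n} (f : Fin n → Bool) (q : Subset n) →
                        ∣ tabulate f ∣ + ∣ q ∣ ≤ n + neighboursIn f q
∣f∣+∣q∣≤n+neighboursIn f [] = z≤n
∣f∣+∣q∣≤n+neighboursIn {suc n} f (true ∷ q)
  rewrite ∑-map (boolToℕ ∘ f) Fin.suc (elements q)
  with f Fin.zero | ∣f∣+∣q∣≤n+neighboursIn (f ∘ Fin.suc) q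
... | true  | ih = s≤s (subst₂ _≤_ (sym (+-suc _ _)) (sym (+-suc n _)) (s≤s ih))
... | false | ih = subst (_≤ suc (n + neighboursIn (f ∘ Fin.suc) q)) (sym (+-suc _ ∣ q ∣)) (s≤s ih)
∣f∣+∣q∣≤n+neighboursIn {suc n} f (false ∷ q)
  rewrite ∑-map (boolToℕ ∘ f) Fin.suc (elements q)
  with f Fin.zero | ∣f∣+∣q∣≤n+neighboursIn (f ∘ Fin.suc) q
... | true  | ih = s≤s ih
... | false | ih = ≤-trans ih (n≤1+n _)

transpose : ∀ {n} → BipGraph n → BipGraph n
transpose E j i = E i j

edges : ∀ {n} → BipGraph n → Subset n → Subset n → ℕ
edges E p q = ∑ (λ i → neighboursIn (E i) q) (elements p)

edges-transpose : ∀ {n} (E : BipGraph n) p q → edges E p q ≡ edges (transpose E) q p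
edges-transpose E p q = ∑-comm (λ i j → boolToℕ (E i j)) (elements p) (elements q)

∣p∣+∣q∣≤edges : ∀ {n} (E : BipGraph n) (p q : Subset n) →
  (∀ i → n + 2 ≤ 2 * degree E (inj₁ i)) → ∣ p ∣ + ∣ q ∣ ≡ n + 1 →
  ∣ p ∣ ≤ ∣ q ∣ → 3 ≤ ∣ p ∣ → 2 * ∣ p ∣ ≢ n → ∣ p ∣ + ∣ q ∣ ≤ edges E p q
∣p∣+∣q∣≤edges {n} E p q V₁-dense size p≤q 3≤p 2p≢n = begin
  ∣ p ∣ + ∣ q ∣                        ≡⟨ cong (∣ p ∣ +_) q≡p+c ⟩
  ∣ p ∣ + (∣ p ∣ + c)                  ≤⟨ a+[a+c]≤a*[2+⌊c/2⌋] c 3≤p c≢1 ⟩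
  ∣ p ∣ * (2 + ⌊ c /2⌋)                ≡⟨ cong (_* (2 + ⌊ c /2⌋)) (sym (length-elements p)) ⟩
  length (elements p) * (2 + ⌊ c /2⌋)  ≤⟨ length*≤∑ _ _ (elements p) (All.tabulate λ {i} _ → neighbours≥ i) ⟩
  edges E p q                          ∎
  where
  open ≤-Reasoning
  c : ℕ
  c = ∣ q ∣ ∸ ∣ p ∣
  q≡p+c : ∣ q ∣ ≡ ∣ p ∣ + c
  q≡p+c = sym (m+[n∸m]≡n p≤q)
  size′ : ∣ p ∣ + (∣ p ∣ + c) ≡ n + 1
  size′ = trans (cong (∣ p ∣ +_) (sym q≡p+c)) size
  c≢1 : c ≢ 1
  c≢1 c≡1 = a+[a+1]≢n+1 {n} {∣ p ∣} 2p≢n (subst (λ k → ∣ p ∣ + (∣ p ∣ + k) ≡ n + 1) c≡1 size′)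
  neighbours≥ : ∀ i → 2 + ⌊ c /2⌋ ≤ neighboursIn (E i) q
  neighbours≥ i = 3+c≤2*d⇒2+⌊c/2⌋≤d c _ (3+c≤2*d {n} {∣ p ∣} {c} {degree E (inj₁ i)} size′ (V₁-dense i)
    (subst (λ k → degree E (inj₁ i) + k ≤ n + neighboursIn (E i) q) q≡p+c (∣f∣+∣q∣≤n+neighboursIn (E i) q)))

vertices : ∀ {n} → Subset n → Subset n → List (Vertex n)
vertices S₁ S₂ = map inj₁ (elements S₁) ++ map inj₂ (elements S₂)

module _ {n : ℕ} (S₁ S₂ : Subset n) where

  length-vertices : length (vertices S₁ S₂) ≡ ∣ S₁ ∣ + ∣ S₂ ∣
  length-vertices = trans (length-++ (map inj₁ (elements S₁)))
    (cong₂ _+_ (trans (length-map inj₁ (elements S₁)) (length-elements S₁))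
               (trans (length-map inj₂ (elements S₂)) (length-elements S₂)))

  vertices-unique : Unique (vertices S₁ S₂)
  vertices-unique = Unique-++⁺ (Unique-map⁺ inj₁-injective (elements-unique S₁))
                               (Unique-map⁺ inj₂-injective (elements-unique S₂)) sides-disjoint
    where
    sides-disjoint : ∀ {v} → ¬ (v ∈ map inj₁ (elements S₁) × v ∈ map inj₂ (elements S₂))
    sides-disjoint (v∈₁ , v∈₂) with ∈-map⁻ inj₁ v∈₁ | ∈-map⁻ inj₂ v∈₂
    ... | _ , _ , refl | _ , _ , ()

  ∈-vertices⁻ : ∀ {v} → v ∈ vertices S₁ S₂ → InS S₁ S₂ v
  ∈-vertices⁻ v∈ with ∈-++⁻ (map inj₁ (elements S₁)) v∈
  ... | inj₁ v∈₁ with ∈-map⁻ inj₁ v∈₁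
  ...   | i , i∈ , refl = ∈-elements⁻ S₁ i∈
  ∈-vertices⁻ v∈ | inj₂ v∈₂ with ∈-map⁻ inj₂ v∈₂
  ...   | j , j∈ , refl = ∈-elements⁻ S₂ j∈

adjacent : ∀ {n} → BipGraph n → Vertex n → Vertex n → Bool
adjacent E (inj₁ i) (inj₂ j) = E i j
adjacent E (inj₂ j) (inj₁ i) = E i j
adjacent E (inj₁ _) (inj₁ _) = false
adjacent E (inj₂ _) (inj₂ _) = false

module _ {n : ℕ} (E : BipGraph n) where

  adjacent-sym : ∀ x y → adjacent E x y ≡ adjacent E y x
  adjacent-sym (inj₁ i) (inj₁ j) = refl
  adjacent-sym (inj₁ i) (inj₂ j) = refl
  adjacent-sym (inj₂ j) (inj₁ i) = refl
  adjacent-sym (inj₂ i) (inj₂ j) = refl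

  adjacent-irrefl : ∀ x → adjacent E x x ≡ false
  adjacent-irrefl (inj₁ i) = refl
  adjacent-irrefl (inj₂ j) = refl

  adjacent⇒Adj : ∀ x y → T (adjacent E x y) → Adj E x y
  adjacent⇒Adj (inj₁ i) (inj₂ j) e = e
  adjacent⇒Adj (inj₂ j) (inj₁ i) e = e

  open SimpleGraph (≡-dec Fin._≟_ Fin._≟_) (adjacent E) adjacent-sym adjacent-irrefl

  ClosedWalk⇒ClosedWalkFrom : ∀ x₀ xs → ClosedWalk x₀ xs → ClosedWalkFrom E x₀ xs
  ClosedWalk⇒ClosedWalkFrom x₀ (x ∷ [])     x~x₀      = adjacent⇒Adj x x₀ x~x₀
  ClosedWalk⇒ClosedWalkFrom x₀ (x ∷ y ∷ xs) (x~y , w) = adjacent⇒Adj x y x~y , ClosedWalk⇒ClosedWalkFrom x₀ (y ∷ xs) w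

  Cycle⇒IsCycle : ∀ c → Cycle c → IsCycle E c
  Cycle⇒IsCycle (x ∷ xs) (length≥3 , uniq , w) = length≥3 , uniq , ClosedWalk⇒ClosedWalkFrom x (x ∷ xs) w

  module _ (S₁ S₂ : Subset n) where

    private
      A B : List (Vertex n)
      A = map inj₁ (elements S₁)
      B = map inj₂ (elements S₂)

    2*edges≤degreeSum : 2 * edges E S₁ S₂ ≤ degreeSum (vertices S₁ S₂)
    2*edges≤degreeSum = begin
      2 * edges E S₁ S₂
        ≡⟨ cong (edges E S₁ S₂ +_) (trans (+-identityʳ _) (edges-transpose E S₁ S₂)) ⟩
      edges E S₁ S₂ + edges (transpose E) S₂ S₁
        ≡⟨ sym (cong₂ _+_ edges-from-S₁ edges-from-S₂) ⟩
      ∑ (degreeIn B) A + ∑ (degreeIn A) B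
        ≤⟨ +-mono-≤ (∑-mono-≤ A λ u → subst (degreeIn B u ≤_) (sym (∑-++ _ A B)) (m≤n+m _ _))
                    (∑-mono-≤ B λ u → subst (degreeIn A u ≤_) (sym (∑-++ _ A B)) (m≤m+n _ _)) ⟩
      ∑ (degreeIn (A ++ B)) A + ∑ (degreeIn (A ++ B)) B
        ≡⟨ sym (∑-++ (degreeIn (A ++ B)) A B) ⟩
      degreeSum (vertices S₁ S₂)  ∎
      where
      open ≤-Reasoning
      edges-from-S₁ : ∑ (degreeIn B) A ≡ edges E S₁ S₂
      edges-from-S₁ = trans (∑-map (degreeIn B) inj₁ (elements S₁))
        (∑-cong (elements S₁) λ i → ∑-map (boolToℕ ∘ adjacent E (inj₁ i)) inj₂ (elements S₂))
      edges-from-S₂ : ∑ (degreeIn A) B ≡ edges (transpose E) S₂ S₁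
      edges-from-S₂ = trans (∑-map (degreeIn A) inj₂ (elements S₂))
        (∑-cong (elements S₂) λ j → ∑-map (boolToℕ ∘ adjacent E (inj₂ j)) inj₁ (elements S₁))

    InducedForest⇒edges< : ∀ {m} → ∣ S₁ ∣ + ∣ S₂ ∣ ≡ suc m → InducedForest E S₁ S₂ → edges E S₁ S₂ < suc m
    InducedForest⇒edges< {m} size forest with suc m ≤? edges E S₁ S₂
    ... | no  few  = ≰⇒> few
    ... | yes many =
      let c , c⊆ , cycle = dense⇒CycleIn m (vertices S₁ S₂) (trans (length-vertices S₁ S₂) size)
                             (vertices-unique S₁ S₂) (≤-trans (*-monoʳ-≤ 2 many) 2*edges≤degreeSum)
      in ⊥-elim (forest (c , All.map (∈-vertices⁻ S₁ S₂) c⊆ , Cycle⇒IsCycle c cycle))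

    ∣S₁∣+∣S₂∣≤edges : MinDegreeAtLeastHalfPlusOne E → ∣ S₁ ∣ + ∣ S₂ ∣ ≡ n + 1 →
                      3 ≤ ∣ S₁ ∣ → 3 ≤ ∣ S₂ ∣ → 2 * ∣ S₁ ∣ ≢ n → 2 * ∣ S₂ ∣ ≢ n →
                      ∣ S₁ ∣ + ∣ S₂ ∣ ≤ edges E S₁ S₂
    ∣S₁∣+∣S₂∣≤edges min-degree size 3≤a 3≤b 2a≢n 2b≢n with ≤-total ∣ S₁ ∣ ∣ S₂ ∣
    ... | inj₁ a≤b = ∣p∣+∣q∣≤edges E S₁ S₂ (min-degree ∘ inj₁) size a≤b 3≤a 2a≢n
    ... | inj₂ b≤a = subst₂ _≤_ (+-comm ∣ S₂ ∣ ∣ S₁ ∣) (sym (edges-transpose E S₁ S₂))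
      (∣p∣+∣q∣≤edges (transpose E) S₂ S₁ (min-degree ∘ inj₂) (trans (+-comm ∣ S₂ ∣ ∣ S₁ ∣) size) b≤a 3≤b 2b≢n)

Exceptional : ℕ → ℕ → Set
Exceptional n k = k ≡ 1 ⊎ k ≡ 2 ⊎ 2 * k ≡ n

exceptional? : ∀ n k → Dec (Exceptional n k)
exceptional? n k = k ≟ 1 ⊎-dec k ≟ 2 ⊎-dec 2 * k ≟ n

¬Exceptional⇒3≤ : ∀ {n k} → k ≢ 0 → ¬ Exceptional n k → 3 ≤ k
¬Exceptional⇒3≤ {k = 0}                 k≢0 _    = contradiction refl k≢0
¬Exceptional⇒3≤ {k = 1}                 _   ¬exc = contradiction (inj₁ refl) ¬exc
¬Exceptional⇒3≤ {k = 2}                 _   ¬exc = contradiction (inj₂ (inj₁ refl)) ¬exc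
¬Exceptional⇒3≤ {k = suc (suc (suc _))} _   _    = s≤s (s≤s (s≤s z≤n))

a+b≡n+1⇒a≢0 : ∀ {n a b} → a + b ≡ n + 1 → b ≤ n → a ≢ 0
a+b≡n+1⇒a≢0 {n} size b≤n refl = 1+n≰n (subst (_≤ n) (trans size (+-comm n 1)) b≤n)

theorem2 : (n : ℕ) → 1 ≤ n → (E : BipGraph n) → MinDegreeAtLeastHalfPlusOne E →
    (S₁ S₂ : Subset n) → ∣ S₁ ∣ + ∣ S₂ ∣ ≡ n + 1 → InducedForest E S₁ S₂ →
    ((∣ S₁ ∣ ≡ 1 ⊎ ∣ S₁ ∣ ≡ 2 ⊎ 2 * ∣ S₁ ∣ ≡ n)
      ⊎ (∣ S₂ ∣ ≡ 1 ⊎ ∣ S₂ ∣ ≡ 2 ⊎ 2 * ∣ S₂ ∣ ≡ n))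
theorem2 n _ E min-degree S₁ S₂ size forest
  with exceptional? n ∣ S₁ ∣ ⊎-dec exceptional? n ∣ S₂ ∣
... | yes exceptional = exceptional
... | no ¬exceptional = ⊥-elim (<⇒≱ few-edges many-edges)
  where
  size′ : ∣ S₁ ∣ + ∣ S₂ ∣ ≡ suc n
  size′ = trans size (+-comm n 1)
  ¬exc₁ : ¬ Exceptional n ∣ S₁ ∣
  ¬exc₁ = ¬exceptional ∘ inj₁
  ¬exc₂ : ¬ Exceptional n ∣ S₂ ∣
  ¬exc₂ = ¬exceptional ∘ inj₂
  3≤a : 3 ≤ ∣ S₁ ∣
  3≤a = ¬Exceptional⇒3≤ (a+b≡n+1⇒a≢0 size (∣p∣≤n S₂)) ¬exc₁
  3≤b : 3 ≤ ∣ S₂ ∣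
  3≤b = ¬Exceptional⇒3≤ (a+b≡n+1⇒a≢0 (trans (+-comm ∣ S₂ ∣ ∣ S₁ ∣) size) (∣p∣≤n S₁)) ¬exc₂
  few-edges : edges E S₁ S₂ < suc n
  few-edges = InducedForest⇒edges< E S₁ S₂ size′ forest
  many-edges : suc n ≤ edges E S₁ S₂
  many-edges = subst (_≤ edges E S₁ S₂) size′ (∣S₁∣+∣S₂∣≤edges E S₁ S₂ min-degree size
                 3≤a 3≤b (¬exc₁ ∘ inj₂ ∘ inj₂) (¬exc₂ ∘ inj₂ ∘ inj₂))
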